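{- Let $S$ be a finite set of Boolean state variables, let $I(S)$ specify the initial states and $T(S,S')$ the transition relation of a transition system having the stuttering feature ($T(\mathbf{s},\mathbf{s})=1$ for every state $\mathbf{s}$), and let $P(S)$ be a property. Let $n\ge 0$. Then there is no bad state that is reachable in $n+1$ transitions for the first time (i.e. reachable in $n+1$ transitions but not reachable in any $k\le n$ transitions) if and only if $I_1$ is redundant in $$\exists S_0\cup\dots\cup S_n\,\big[I_0\wedge I_1\wedge T_{0,1}\wedge\dots\wedge T_{n,n+1}\wedge \overline{P}(S_{n+1})\big],$$ i.e. iff this formula is equivalent (as a formula in the free variables $S_{n+1}$) to $\exists S_0\cup\dots\cup S_n\,\big[I_0\wedge T_{0,1}\wedge\dots\wedge T_{n,n+1}\wedge \overline{P}(S_{n+1})\big]$.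
   Context: A state is an assignment to $S$; it is bad if $P(\mathbf{s})=0$ and good if $P(\mathbf{s})=1$. $S_j$ denotes a copy of the state variables for time frame $j$; $I_0=I(S_0)$, $I_1=I(S_1)$, $T_{j,j+1}=T(S_j,S_{j+1})$. A trace $\mathbf{s}_0,\dots,\mathbf{s}_k$ is valid if $I(\mathbf{s}_0)=1$ and $T(\mathbf{s}_i,\mathbf{s}_{i+1})=1$ for $i<k$; then $\mathbf{s}_k$ is reachable in $k$ transitions. A formula $A$ is redundant in $\exists X\,[A\wedge B]$ if $\exists X\,[A\wedge B]\equiv\exists X\,[B]$. -}

module Defs where

open import Data.Bool using (Bool; true; false)
open import Data.Nat using (ℕ; suc; _≤_)
open import Data.Fin using (Fin; zero; inject₁; fromℕ)
open import Data.Vec using (Vec)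
open import Data.Product using (Σ; _×_)
open import Relation.Binary.PropositionalEquality using (_≡_)
open import Relation.Nullary using (¬_)
open import Function.Bundles using (_⇔_)

State : ℕ → Set
State m = Vec Bool m

record System (m : ℕ) : Set where
  field
    I : State m → Bool
    T : State m → State m → Bool
    P : State m → Bool

Stuttering : ∀ {m} → System m → Set
Stuttering sys = ∀ s → System.T sys s s ≡ true

Seq : ℕ → ℕ → Set
Seq m k = Fin (suc k) → State m

Transitions : ∀ {m} → System m → (k : ℕ) → Seq m k → Set
Transitions sys k tr = ∀ (i : Fin k) → System.T sys (tr (inject₁ i)) (tr (Data.Fin.suc i)) ≡ true

ValidTrace : ∀ {m} → System m → (k : ℕ) → Seq m k → Set
ValidTrace sys k tr = (System.I sys (tr zero) ≡ true) × Transitions sys k tr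

ReachableIn : ∀ {m} → System m → ℕ → State m → Set
ReachableIn {m} sys k s = Σ (Seq m k) λ tr → ValidTrace sys k tr × (tr (fromℕ k) ≡ s)

Bad : ∀ {m} → System m → State m → Set
Bad sys s = System.P sys s ≡ false

FirstReachableIn : ∀ {m} → System m → ℕ → State m → Set
FirstReachableIn sys n s =
  ReachableIn sys (suc n) s × (∀ k → k ≤ n → ¬ ReachableIn sys k s)

-- The formula ∃ S_0 ∪ … ∪ S_n [ I_0 ∧ I_1 ∧ T_{0,1} ∧ … ∧ T_{n,n+1} ∧ ¬P(S_{n+1}) ]
-- evaluated at an assignment s to the free variables S_{n+1}.
WithI1 : ∀ {m} → System m → (n : ℕ) → State m → Set
WithI1 {m} sys n s =
  Σ (Seq m (suc n)) λ tr →
    (tr (fromℕ (suc n)) ≡ s) ×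
    (System.I sys (tr zero) ≡ true) ×
    (System.I sys (tr (Data.Fin.suc zero)) ≡ true) ×
    Transitions sys (suc n) tr ×
    (System.P sys (tr (fromℕ (suc n))) ≡ false)

WithoutI1 : ∀ {m} → System m → (n : ℕ) → State m → Set
WithoutI1 {m} sys n s =
  Σ (Seq m (suc n)) λ tr →
    (tr (fromℕ (suc n)) ≡ s) ×
    (System.I sys (tr zero) ≡ true) ×
    Transitions sys (suc n) tr ×
    (System.P sys (tr (fromℕ (suc n))) ≡ false)

I1Redundant : ∀ {m} → System m → ℕ → Set
I1Redundant sys n = ∀ s → WithI1 sys n s ⇔ WithoutI1 sys n s

-- With stuttering, prepending a copy of the initial state turns a trace of length n
-- into one of length n + 1 whose frames 0 and 1 are both initial, and dropping frame 0
-- of such a trace gives back a valid trace of length n.  Hence the formula with I₁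
-- holds exactly at the bad states reachable in n transitions, the one without I₁ at
-- the bad states reachable in n + 1 transitions, and the reachable sets grow with the
-- number of transitions.  Redundancy of I₁ thus says that no bad state is reachable in
-- n + 1 but not in n transitions, i.e. none is reachable for the first time.  The step
-- from "not first reachable" to "reachable in n" is a case split on reachability,
-- which is decidable because there are finitely many states.
module Submission where

open import Defs
open import Data.Nat using (ℕ; zero; suc; _≤_; _≤′_; ≤′-reflexive; ≤′-step)
open import Data.Nat.Properties using (≤-refl; ≤⇒≤′)
open import Data.Fin using (fromℕ) renaming (zero to fzero; suc to fsuc)
open import Data.Vec using (Vec; []; _∷_)
open import Data.Vec.Properties using (≡-dec)
import Data.Vec.Functional as Seq
open import Data.Bool using (Bool; true; false)
open import Data.Bool.Properties using (_≟_)
open import Data.Product using (Σ; ∃; ∃-syntax; _×_; _,_; proj₂)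
open import Data.Sum using (inj₁; inj₂)
open import Data.Empty using (⊥-elim)
open import Relation.Nullary using (¬_; Dec; yes; no)
open import Relation.Nullary.Decidable using (map′; _×-dec_; _⊎-dec_)
import Relation.Nullary.Decidable as Dec
open import Relation.Binary.PropositionalEquality using (_≡_; refl)
open import Function.Bundles using (_⇔_; mk⇔; Equivalence)
open import Function.Properties.Equivalence using () renaming (sym to ⇔-sym)

Searchable : Set → Set₁
Searchable A = ∀ {P : A → Set} → (∀ x → Dec (P x)) → Dec (∃ P)

Bool-searchable : Searchable Bool
Bool-searchable P? =
  map′ (λ { (inj₁ p) → true , p ; (inj₂ p) → false , p })
       (λ { (true , p) → inj₁ p ; (false , p) → inj₂ p })
       (P? true ⊎-dec P? false)

Vec-searchable : ∀ {A} → Searchable A → ∀ n → Searchable (Vec A n)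
Vec-searchable A-search zero P? = map′ ([] ,_) (λ { ([] , p) → p }) (P? [])
Vec-searchable A-search (suc n) P? =
  map′ (λ { (x , xs , p) → x ∷ xs , p }) (λ { (x ∷ xs , p) → x , xs , p })
       (A-search λ x → Vec-searchable A-search n λ xs → P? (x ∷ xs))

module _ {m : ℕ} (sys : System m) where
  open System sys

  Path : ℕ → State m → State m → Set
  Path k a b = Σ (Seq m k) λ tr → (tr fzero ≡ a) × Transitions sys k tr × (tr (fromℕ k) ≡ b)

  transitions-∷ : ∀ {k a} {tr : Seq m k} →
    T a (tr fzero) ≡ true → Transitions sys k tr → Transitions sys (suc k) (a Seq.∷ tr)
  transitions-∷ t₀ ts fzero    = t₀
  transitions-∷ t₀ ts (fsuc i) = ts i

  transitions-tail : ∀ {k} (tr : Seq m (suc k)) →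
    Transitions sys (suc k) tr → Transitions sys k (Seq.tail tr)
  transitions-tail tr ts i = ts (fsuc i)

  Path-zero-⇔ : ∀ {a b} → Path 0 a b ⇔ (a ≡ b)
  Path-zero-⇔ {a} = mk⇔ (λ { (tr , refl , _ , refl) → refl })
                        (λ { refl → (λ _ → a) , refl , (λ ()) , refl })

  Path-suc-⇔ : ∀ {k a b} → Path (suc k) a b ⇔ (∃[ c ] (T a c ≡ true) × Path k c b)
  Path-suc-⇔ {k} {a} {b} = mk⇔ split join
    where
    split : Path (suc k) a b → ∃[ c ] (T a c ≡ true) × Path k c b
    split (tr , refl , ts , e) =
      tr (fsuc fzero) , ts fzero , Seq.tail tr , refl , transitions-tail tr ts , e
    join : ∃[ c ] (T a c ≡ true) × Path k c b → Path (suc k) a b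
    join (c , t₀ , tr , refl , ts , e) = a Seq.∷ tr , refl , transitions-∷ t₀ ts , e

  ReachableIn-⇔ : ∀ {k s} → ReachableIn sys k s ⇔ (∃[ a ] (I a ≡ true) × Path k a s)
  ReachableIn-⇔ = mk⇔ (λ { (tr , (i₀ , ts) , e) → tr fzero , i₀ , tr , refl , ts , e })
                      (λ { (a , i₀ , tr , refl , ts , e) → tr , (i₀ , ts) , e })

  State-searchable : Searchable (State m)
  State-searchable = Vec-searchable Bool-searchable m

  path? : ∀ k a b → Dec (Path k a b)
  path? zero    a b = Dec.map (⇔-sym Path-zero-⇔) (≡-dec _≟_ a b)
  path? (suc k) a b = Dec.map (⇔-sym Path-suc-⇔)
    (State-searchable λ c → (T a c ≟ true) ×-dec path? k c b)

  reachable? : ∀ k s → Dec (ReachableIn sys k s)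
  reachable? k s = Dec.map (⇔-sym ReachableIn-⇔)
    (State-searchable λ a → (I a ≟ true) ×-dec path? k a s)

  module _ (stuttering : Stuttering sys) where

    stutter-first : ∀ {k} {tr : Seq m k} →
      Transitions sys k tr → Transitions sys (suc k) (tr fzero Seq.∷ tr)
    stutter-first {tr = tr} = transitions-∷ (stuttering (tr fzero))

    reachable-suc : ∀ {k s} → ReachableIn sys k s → ReachableIn sys (suc k) s
    reachable-suc (tr , (i₀ , ts) , e) = tr fzero Seq.∷ tr , (i₀ , stutter-first ts) , e

    reachable-mono : ∀ {k j s} → k ≤ j → ReachableIn sys k s → ReachableIn sys j s
    reachable-mono {k} {s = s} k≤j r = go (≤⇒≤′ k≤j)
      where
      go : ∀ {j} → k ≤′ j → ReachableIn sys j s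
      go (≤′-reflexive refl) = r
      go (≤′-step k≤′j)      = reachable-suc (go k≤′j)

    WithI1-⇔ : ∀ {n s} → WithI1 sys n s ⇔ (Bad sys s × ReachableIn sys n s)
    WithI1-⇔ {n} {s} = mk⇔ drop-first prepend-initial
      where
      drop-first : WithI1 sys n s → Bad sys s × ReachableIn sys n s
      drop-first (tr , refl , _ , i₁ , ts , bad) =
        bad , Seq.tail tr , (i₁ , transitions-tail tr ts) , refl
      prepend-initial : Bad sys s × ReachableIn sys n s → WithI1 sys n s
      prepend-initial (bad , tr , (i₀ , ts) , refl) =
        tr fzero Seq.∷ tr , refl , i₀ , i₀ , stutter-first ts , bad

  WithoutI1-⇔ : ∀ {n s} → WithoutI1 sys n s ⇔ (Bad sys s × ReachableIn sys (suc n) s)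
  WithoutI1-⇔ = mk⇔ (λ { (tr , refl , i₀ , ts , bad) → bad , tr , (i₀ , ts) , refl })
                    (λ { (bad , tr , (i₀ , ts) , refl) → tr , refl , i₀ , ts , bad })

proposition2 : ∀ (m : ℕ) (sys : System m) → Stuttering sys → (n : ℕ) →
    (¬ (Σ (State m) λ s → Bad sys s × FirstReachableIn sys n s)) ⇔ I1Redundant sys n
proposition2 m sys stuttering n = mk⇔ redundant no-first
  where
  open Equivalence
  redundant : ¬ (Σ (State m) λ s → Bad sys s × FirstReachableIn sys n s) → I1Redundant sys n
  redundant none s = mk⇔
    (λ w → let bad , r = WithI1-⇔ sys stuttering .to w
           in WithoutI1-⇔ sys .from (bad , reachable-suc sys stuttering r))
    (λ w → let bad , r = WithoutI1-⇔ sys .to w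
           in WithI1-⇔ sys stuttering .from (bad , reachable-earlier bad r))
    where
    reachable-earlier : Bad sys s → ReachableIn sys (suc n) s → ReachableIn sys n s
    reachable-earlier bad r with reachable? sys n s
    ... | yes rₙ = rₙ
    ... | no ¬rₙ = ⊥-elim (none (s , bad , r , λ k k≤n rₖ → ¬rₙ (reachable-mono sys stuttering k≤n rₖ)))
  no-first : I1Redundant sys n → ¬ (Σ (State m) λ s → Bad sys s × FirstReachableIn sys n s)
  no-first red (s , bad , r , never) = never n ≤-refl (proj₂ (WithI1-⇔ sys stuttering .to w))
    where
    w : WithI1 sys n s
    w = red s .from (WithoutI1-⇔ sys .from (bad , r))
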